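{- Let $\lambda$ be a trapezoidal shifted Young diagram, i.e. $\lambda=(N,N-2,\dots,N-2n+2)$ for integers $n\ge1$, $N-2n+2\ge1$. Then the expectation $\mathbb{E}(X)$ for the lower interval $[\emptyset,\lambda]$ of the shifted Young's lattice equals \[ \mathbb{E}(X)=\frac{|\lambda|}{\lambda_1+1}. \]
   Context: The shifted Young diagram of a strict partition $\lambda$ is $\{(i,j):1\le i\le\ell(\lambda),\ i\le j\le\lambda_i+i-1\}$; the shifted Young's lattice is the poset of strict partitions (including $\emptyset$) ordered by inclusion of shifted diagrams. For a finite poset $P$, $\mathrm{ddeg}(x)$ is the number of elements covered by $x$, and $X$ is the random variable $\mathrm{ddeg}(x)$ for $x$ chosen uniformly at random from $P$. -}

module Defs where

open import Data.Nat using (ℕ; zero; suc; _+_; _*_; _∸_; _≤_; _<_; _>_)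
open import Data.List using (List; []; _∷_; length; lookup; map)
open import Data.Nat.ListAction using (sum)
open import Data.List.Relation.Unary.All using (All)
open import Data.List.Relation.Unary.Unique.Propositional using (Unique)
open import Data.List.Relation.Unary.Linked using (Linked)
open import Data.List.Membership.Propositional using (_∈_)
open import Data.Fin using (Fin; toℕ)
open import Data.Product using (Σ; _×_; ∃)
open import Data.Sum using (_⊎_)
open import Data.Empty using (⊥)
open import Relation.Nullary using (¬_)
open import Relation.Binary.PropositionalEquality using (_≡_)

StrictPartition : List ℕ → Set
StrictPartition μ = Linked _>_ μ × All (λ p → 0 < p) μ

-- Cell (i , j) (1-indexed) lies in the shifted Young diagram of μ:
-- 1 ≤ i ≤ ℓ(μ) and i ≤ j ≤ μ_i + i - 1.
InShiftedDiagram : List ℕ → ℕ → ℕ → Set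
InShiftedDiagram μ i j =
  Σ (Fin (length μ)) λ k → (i ≡ suc (toℕ k)) × (i ≤ j) × (j < lookup μ k + i)

_⊑_ : List ℕ → List ℕ → Set
μ ⊑ ν = ∀ i j → InShiftedDiagram μ i j → InShiftedDiagram ν i j

_⊏_ : List ℕ → List ℕ → Set
μ ⊏ ν = (μ ⊑ ν) × ¬ (ν ⊑ μ)

-- y is covered by x in the shifted Young's lattice (equivalently in any
-- interval containing both, intervals being convex).
_⋖_ : List ℕ → List ℕ → Set
y ⋖ x = (y ⊏ x) × (∀ z → StrictPartition z → ¬ ((y ⊏ z) × (z ⊏ x)))

InInterval : List ℕ → List ℕ → Set
InInterval lam μ = StrictPartition μ × (μ ⊑ lam)

Enumerates : List ℕ → List (List ℕ) → Set
Enumerates lam L = Unique L × (∀ μ → (μ ∈ L → InInterval lam μ) × (InInterval lam μ → μ ∈ L))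

-- C x lists, without repetition, exactly the elements of [∅, λ] covered by x,
-- so length (C x) = ddeg(x).
CoverLists : List ℕ → (List ℕ → List (List ℕ)) → Set
CoverLists lam C = ∀ x → InInterval lam x →
  Unique (C x) × (∀ y → (y ∈ C x → InInterval lam y × (y ⋖ x)) × (InInterval lam y × (y ⋖ x) → y ∈ C x))

trapezoid : ℕ → ℕ → List ℕ
trapezoid N zero = []
trapezoid N (suc n) = N ∷ trapezoid (N ∸ 2) n

totalDdeg : List (List ℕ) → (List ℕ → List (List ℕ)) → ℕ
totalDdeg L C = sum (map (λ x → length (C x)) L)

size : List ℕ → ℕ
size = sum

-- The interval [∅, λ] for λ = trapezoid N n consists of the strict partitions μ with at
-- most n parts and μᵢ + 2(i − 1) ≤ N. Such a μ either has no part 1, so μ = ν + (1, …, 1),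
-- or μ = (ν₁ + 1, …, ν_ℓ + 1, 1) with ℓ < n, and in both cases ν lies in the interval for
-- N − 1. This gives Pascal recurrences in N: the interval has (N+1 choose n) elements, and
-- since the first operation preserves ddeg while the second adds one exactly when ν has no
-- part 1, the down-degrees sum to n·(N choose n). Absorption, (N+1)·(N choose n) =
-- (N+1−n)·(N+1 choose n), and |λ| = n(N+1−n) turn this into the stated ratio.

module Submission where

open import Defs
open import Data.Nat using (ℕ; zero; suc; pred; _+_; _*_; _∸_; _≤_; _<_; z≤n; s≤s; z<s; s<s; _≟_; _<?_; _≤?_)
open import Data.Nat.Properties
open import Data.Nat.Combinatorics using (_C_; nCk+nC[k+1]≡[n+1]C[k+1]; nCk≡nC[n∸k]; nC1≡n)
open import Data.Nat.ListAction using (sum)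
open import Data.Nat.ListAction.Properties using (sum-++; sum-↭)
open import Data.Nat.Tactic.RingSolver using (solve-∀)
open import Data.Fin using (Fin; toℕ) renaming (zero to fzero; suc to fsuc)
open import Data.List using (List; []; _∷_; length; map; _++_; lookup)
open import Data.List.Properties using (∷-injective; ∷-injectiveˡ; ∷-injectiveʳ; map-++; map-∘; map-cong-local; length-map; length-++)
open import Data.List.Relation.Unary.All as All using ([]; _∷_)
open import Data.List.Relation.Unary.Any using (here)
open import Data.List.Relation.Unary.Linked using ([]; [-]; _∷_)
open import Data.List.Relation.Unary.Unique.Propositional using (Unique)
open import Data.List.Relation.Unary.AllPairs using ([]; _∷_)
import Data.List.Relation.Unary.Unique.Propositional.Properties as Unique
open import Data.List.Membership.Propositional using (_∈_)
open import Data.List.Membership.Propositional.Properties using (∈-++⁺ˡ; ∈-++⁺ʳ; ∈-++⁻; ∈-map⁺; ∈-map⁻)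
open import Data.List.Membership.Propositional.Properties.WithK using (unique∧set⇒bag)
open import Data.List.Relation.Binary.BagAndSetEquality using (∼bag⇒↭)
open import Data.List.Relation.Binary.Permutation.Propositional using (_↭_)
open import Data.List.Relation.Binary.Permutation.Propositional.Properties using (↭-length) renaming (map⁺ to ↭-map⁺)
open import Data.Product using (Σ; _×_; _,_; proj₁; proj₂)
open import Data.Sum using (_⊎_; inj₁; inj₂)
open import Data.Empty using (⊥)
open import Data.Unit using (⊤; tt)
open import Function.Base using (_∘_; const)
open import Function.Bundles using (_⇔_; mk⇔; Equivalence)
open import Function.Properties.Equivalence using () renaming (trans to ⇔-trans; sym to ⇔-sym)
open import Relation.Nullary using (¬_; yes; no; contradiction)
open import Relation.Binary.PropositionalEquality
open import Algebra.Properties.CommutativeSemigroup +-commutativeSemigroup using () renaming (interchange to +-interchange)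

∑ : {A : Set} → (A → ℕ) → List A → ℕ
∑ f xs = sum (map f xs)

module _ {A : Set} {xs ys : List A} where

  same-members⇒↭ : Unique xs → Unique ys → (∀ {z} → z ∈ xs ⇔ z ∈ ys) → xs ↭ ys
  same-members⇒↭ ux uy eq = ∼bag⇒↭ (unique∧set⇒bag ux uy eq)

  ∑-↭ : (f : A → ℕ) → xs ↭ ys → ∑ f xs ≡ ∑ f ys
  ∑-↭ f p = sum-↭ (↭-map⁺ f p)

module _ {A : Set} where

  ∑-++ : (f : A → ℕ) (xs ys : List A) → ∑ f (xs ++ ys) ≡ ∑ f xs + ∑ f ys
  ∑-++ f xs ys = trans (cong sum (map-++ f xs ys)) (sum-++ (map f xs) (map f ys))

  ∑-map : {B : Set} (f : B → ℕ) (g : A → B) (xs : List A) → ∑ f (map g xs) ≡ ∑ (f ∘ g) xs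
  ∑-map f g xs = cong sum (sym (map-∘ xs))

  ∑-cong : {f g : A → ℕ} (xs : List A) → (∀ {x} → x ∈ xs → f x ≡ g x) → ∑ f xs ≡ ∑ g xs
  ∑-cong xs eq = cong sum (map-cong-local (All.tabulate eq))

  ∑-+ : (f g : A → ℕ) (xs : List A) → ∑ (λ x → f x + g x) xs ≡ ∑ f xs + ∑ g xs
  ∑-+ f g [] = refl
  ∑-+ f g (x ∷ xs) = trans (cong (f x + g x +_) (∑-+ f g xs)) (+-interchange (f x) (g x) _ _)

  ∑-const-0 : (xs : List A) → ∑ (const 0) xs ≡ 0
  ∑-const-0 [] = refl
  ∑-const-0 (x ∷ xs) = ∑-const-0 xs

  ∑-const-1 : (xs : List A) → ∑ (const 1) xs ≡ length xs
  ∑-const-1 [] = refl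
  ∑-const-1 (x ∷ xs) = cong suc (∑-const-1 xs)

-- Inclusion of shifted diagrams is the partwise order

-- The k-th part (from 0), with 0 beyond the last part.
part : List ℕ → ℕ → ℕ
part [] _ = 0
part (a ∷ μ) zero = a
part (a ∷ μ) (suc k) = part μ k

_≤ₚ_ : List ℕ → List ℕ → Set
μ ≤ₚ ν = ∀ k → part μ k ≤ part ν k

lookup≡part : (μ : List ℕ) (k : Fin (length μ)) → lookup μ k ≡ part μ (toℕ k)
lookup≡part (a ∷ μ) fzero = refl
lookup≡part (a ∷ μ) (fsuc k) = lookup≡part μ k

part>0⇒index : (μ : List ℕ) (k : ℕ) → 0 < part μ k → Σ (Fin (length μ)) λ i → toℕ i ≡ k
part>0⇒index (a ∷ μ) zero _ = fzero , refl
part>0⇒index (a ∷ μ) (suc k) p with part>0⇒index μ k p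
... | i , refl = fsuc i , refl

inDiagram⇔ : ∀ μ k j → InShiftedDiagram μ (suc k) j ⇔ (suc k ≤ j × j < part μ k + suc k)
inDiagram⇔ μ k j = mk⇔ to from
  where
  to : InShiftedDiagram μ (suc k) j → suc k ≤ j × j < part μ k + suc k
  to (i , refl , k<j , j<) = k<j , subst (λ t → j < t + suc k) (lookup≡part μ i) j<
  from : suc k ≤ j × j < part μ k + suc k → InShiftedDiagram μ (suc k) j
  from (k<j , j<) with part>0⇒index μ k (+-cancelʳ-< (suc k) 0 _ (≤-<-trans k<j j<))
  ... | i , refl = i , refl , k<j , subst (λ t → j < t + suc k) (sym (lookup≡part μ i)) j<

⊑⇒≤ₚ : ∀ μ ν → μ ⊑ ν → μ ≤ₚ ν
⊑⇒≤ₚ μ ν μ⊑ν k with part μ k in eq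
... | zero = z≤n
... | suc p = +-cancelʳ-< (suc k) p (part ν k) (proj₂ (to (inDiagram⇔ ν k _) (μ⊑ν (suc k) _ lastCell)))
  where
  open Equivalence
  lastCell : InShiftedDiagram μ (suc k) (p + suc k)
  lastCell = from (inDiagram⇔ μ k _) (m≤n+m (suc k) p , subst (λ t → p + suc k < t + suc k) (sym eq) ≤-refl)

≤ₚ⇒⊑ : ∀ μ ν → μ ≤ₚ ν → μ ⊑ ν
≤ₚ⇒⊑ μ ν μ≤ν zero j (_ , () , _)
≤ₚ⇒⊑ μ ν μ≤ν (suc k) j cell with Equivalence.to (inDiagram⇔ μ k j) cell
... | k<j , j< = Equivalence.from (inDiagram⇔ ν k j) (k<j , <-≤-trans j< (+-monoˡ-≤ (suc k) (μ≤ν k)))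

-- Strict partitions as lists decreasing to an implicit final part 0

data Strict : List ℕ → Set where
  [] : Strict []
  _∷_ : ∀ {a μ} → part μ 0 < a → Strict μ → Strict (a ∷ μ)

strict-tail : ∀ {a μ} → Strict (a ∷ μ) → Strict μ
strict-tail (_ ∷ s) = s

strict-head : ∀ {a μ} → Strict (a ∷ μ) → part μ 0 < a
strict-head (h ∷ _) = h

strict-head>0 : ∀ {a μ} → Strict (a ∷ μ) → 0 < a
strict-head>0 (h ∷ _) = ≤-<-trans z≤n h

strictPartition⇒strict : ∀ μ → StrictPartition μ → Strict μ
strictPartition⇒strict [] _ = []
strictPartition⇒strict (a ∷ []) (_ , a>0 ∷ []) = a>0 ∷ []
strictPartition⇒strict (a ∷ b ∷ μ) (a>b ∷ dec , _ ∷ pos) = a>b ∷ strictPartition⇒strict (b ∷ μ) (dec , pos)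

strict⇒strictPartition : ∀ {μ} → Strict μ → StrictPartition μ
strict⇒strictPartition [] = [] , []
strict⇒strictPartition (a>0 ∷ []) = [-] , a>0 ∷ []
strict⇒strictPartition (a>b ∷ s@(_ ∷ _)) with strict⇒strictPartition s
... | dec , pos@(b>0 ∷ _) = a>b ∷ dec , <-trans b>0 a>b ∷ pos

size-mono-≤ₚ : ∀ μ ν → μ ≤ₚ ν → size μ ≤ size ν
size-mono-≤ₚ [] ν _ = z≤n
size-mono-≤ₚ (a ∷ μ) [] μ≤ν = +-mono-≤ (μ≤ν 0) (size-mono-≤ₚ μ [] (μ≤ν ∘ suc))
size-mono-≤ₚ (a ∷ μ) (b ∷ ν) μ≤ν = +-mono-≤ (μ≤ν 0) (size-mono-≤ₚ μ ν (μ≤ν ∘ suc))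

part≤size : ∀ μ k → part μ k ≤ size μ
part≤size [] k = z≤n
part≤size (a ∷ μ) zero = m≤m+n a (size μ)
part≤size (a ∷ μ) (suc k) = ≤-trans (part≤size μ k) (m≤n+m (size μ) a)

+-≤-≡-split : ∀ {a b c d} → a ≤ b → c ≤ d → a + c ≡ b + d → a ≡ b × c ≡ d
+-≤-≡-split {a} {b} {c} {d} a≤b c≤d eq = a≡b , +-cancelˡ-≡ b c d (subst (λ t → t + c ≡ b + d) a≡b eq)
  where
  a≡b : a ≡ b
  a≡b = ≤-antisym a≤b (+-cancelʳ-≤ d b a (subst (_≤ a + d) eq (+-monoʳ-≤ a c≤d)))

≤ₚ∧size≡⇒≥ₚ : ∀ μ ν → μ ≤ₚ ν → size μ ≡ size ν → ν ≤ₚ μ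
≤ₚ∧size≡⇒≥ₚ [] ν _ eq k = subst (part ν k ≤_) (sym eq) (part≤size ν k)
≤ₚ∧size≡⇒≥ₚ (a ∷ μ) [] _ _ k = z≤n
≤ₚ∧size≡⇒≥ₚ (a ∷ μ) (b ∷ ν) μ≤ν eq k with +-≤-≡-split (μ≤ν 0) (size-mono-≤ₚ μ ν (μ≤ν ∘ suc)) eq | k
... | a≡b , _ | zero = ≤-reflexive (sym a≡b)
... | _ , eq′ | suc k′ = ≤ₚ∧size≡⇒≥ₚ μ ν (μ≤ν ∘ suc) eq′ k′

≤ₚ-antisym : ∀ {μ ν} → Strict μ → Strict ν → μ ≤ₚ ν → ν ≤ₚ μ → μ ≡ ν
≤ₚ-antisym [] [] _ _ = refl
≤ₚ-antisym [] sν@(_ ∷ _) _ ν≤μ = contradiction (ν≤μ 0) (<⇒≱ (strict-head>0 sν))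
≤ₚ-antisym sμ@(_ ∷ _) [] μ≤ν _ = contradiction (μ≤ν 0) (<⇒≱ (strict-head>0 sμ))
≤ₚ-antisym (_ ∷ sμ) (_ ∷ sν) μ≤ν ν≤μ =
  cong₂ _∷_ (≤-antisym (μ≤ν 0) (ν≤μ 0)) (≤ₚ-antisym sμ sν (μ≤ν ∘ suc) (ν≤μ ∘ suc))

⊏⇒size< : ∀ μ ν → μ ⊑ ν → ¬ (ν ⊑ μ) → size μ < size ν
⊏⇒size< μ ν μ⊑ν ν⋢μ with m≤n⇒m<n∨m≡n (size-mono-≤ₚ μ ν (⊑⇒≤ₚ μ ν μ⊑ν))
... | inj₁ lt = lt
... | inj₂ eq = contradiction (≤ₚ⇒⊑ ν μ (≤ₚ∧size≡⇒≥ₚ μ ν (⊑⇒≤ₚ μ ν μ⊑ν) eq)) ν⋢μ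

-- The elements covered by a strict partition

singleCellCover : ℕ → List ℕ → List (List ℕ)
singleCellCover a (_ ∷ _) = []
singleCellCover 1 [] = [] ∷ []
singleCellCover _ [] = []

-- The last cell of the first row is removable when that row stays longer than the
-- second (read with the convention part [] 0 = 0), or when it is the only cell.
firstRowCovers : ℕ → List ℕ → List (List ℕ)
firstRowCovers a μ with suc (part μ 0) <? a
... | yes _ = (pred a ∷ μ) ∷ []
... | no _ = singleCellCover a μ

covers : List ℕ → List (List ℕ)
covers [] = []
covers (a ∷ μ) = firstRowCovers a μ ++ map (a ∷_) (covers μ)

OneCellBelow : List ℕ → List ℕ → Set
OneCellBelow μ κ = Strict κ × κ ≤ₚ μ × suc (size κ) ≡ size μ

firstRowCovers-sound : ∀ a μ κ → κ ∈ firstRowCovers a μ → Strict (a ∷ μ) → OneCellBelow (a ∷ μ) κ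
firstRowCovers-sound a μ κ κ∈ s with suc (part μ 0) <? a
firstRowCovers-sound (suc a) μ κ (here refl) s | yes (s≤s μ₁<a) =
  μ₁<a ∷ strict-tail s , (λ { zero → n≤1+n a ; (suc k) → ≤-refl }) , refl
firstRowCovers-sound (suc zero) [] κ (here refl) s | no _ = [] , (λ _ → z≤n) , refl

firstRowCovers-∋ : ∀ a μ → suc (part μ 0) < a → (pred a ∷ μ) ∈ firstRowCovers a μ
firstRowCovers-∋ a μ lt with suc (part μ 0) <? a
... | yes _ = here refl
... | no ¬lt = contradiction lt ¬lt

firstRowCovers-unique : ∀ a μ → Unique (firstRowCovers a μ)
firstRowCovers-unique a μ with suc (part μ 0) <? a
... | yes _ = [] ∷ []
firstRowCovers-unique (suc zero) [] | no _ = [] ∷ []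
firstRowCovers-unique zero [] | no _ = []
firstRowCovers-unique (suc (suc a)) [] | no _ = []
firstRowCovers-unique a (_ ∷ _) | no _ = []

firstRowCovers-∌-a∷ : ∀ a μ ν → a ∷ ν ∈ firstRowCovers a μ → ⊥
firstRowCovers-∌-a∷ a μ ν ∈frc with suc (part μ 0) <? a
firstRowCovers-∌-a∷ (suc a) μ ν (here eq) | yes _ = 1+n≢n (∷-injectiveˡ eq)
firstRowCovers-∌-a∷ (suc zero) [] ν (here ()) | no _

covers-sound : ∀ μ κ → κ ∈ covers μ → Strict μ → OneCellBelow μ κ
covers-sound (a ∷ μ) κ κ∈ s with ∈-++⁻ (firstRowCovers a μ) κ∈
... | inj₁ κ∈frc = firstRowCovers-sound a μ κ κ∈frc s
... | inj₂ κ∈map with ∈-map⁻ (a ∷_) κ∈map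
...   | κ′ , κ′∈ , refl with covers-sound μ κ′ κ′∈ (strict-tail s)
...     | sκ′ , κ′≤μ , eq =
  ≤-<-trans (κ′≤μ 0) (strict-head s) ∷ sκ′ ,
  (λ { zero → ≤-refl ; (suc k) → κ′≤μ k }) ,
  trans (sym (+-suc a (size κ′))) (cong (a +_) eq)

covers-unique : ∀ μ → Unique (covers μ)
covers-unique [] = []
covers-unique (a ∷ μ) = Unique.++⁺ (firstRowCovers-unique a μ) (Unique.map⁺ ∷-injectiveʳ (covers-unique μ)) disjoint
  where
  disjoint : ∀ {κ} → κ ∈ firstRowCovers a μ × κ ∈ map (a ∷_) (covers μ) → ⊥
  disjoint (κ∈frc , κ∈map) with ∈-map⁻ (a ∷_) κ∈map
  ... | ν , _ , refl = firstRowCovers-∌-a∷ a μ ν κ∈frc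

∷-∈-covers : ∀ a {μ κ} → κ ∈ covers μ → a ∷ κ ∈ covers (a ∷ μ)
∷-∈-covers a {μ} κ∈ = ∈-++⁺ʳ (firstRowCovers a μ) (∈-map⁺ (a ∷_) κ∈)

size>0 : ∀ {a μ} → Strict (a ∷ μ) → 0 < size (a ∷ μ)
size>0 s = ≤-trans (strict-head>0 s) (m≤m+n _ _)

below-some-cover : ∀ μ ν → Strict μ → Strict ν → ν ≤ₚ μ → size ν < size μ →
                   Σ (List ℕ) λ κ → κ ∈ covers μ × ν ≤ₚ κ
below-some-cover (suc zero ∷ []) [] _ _ _ _ = [] , here refl , λ _ → z≤n
below-some-cover (suc (suc a) ∷ []) [] _ _ _ _ =
  suc a ∷ [] , ∈-++⁺ˡ (firstRowCovers-∋ (suc (suc a)) [] (s≤s (s≤s z≤n))) , λ _ → z≤n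
below-some-cover (a ∷ μ@(_ ∷ _)) [] sμ [] _ _
  with below-some-cover μ [] (strict-tail sμ) [] (λ _ → z≤n) (size>0 (strict-tail sμ))
... | κ , κ∈ , _ = a ∷ κ , ∷-∈-covers a κ∈ , λ _ → z≤n
below-some-cover (a ∷ μ) (b ∷ ν) sμ sν ν≤μ ν<μ
  with m≤n⇒m<n∨m≡n (size-mono-≤ₚ ν μ (ν≤μ ∘ suc))
... | inj₁ tail< with below-some-cover μ ν (strict-tail sμ) (strict-tail sν) (ν≤μ ∘ suc) tail<
...   | κ , κ∈ , ν≤κ = a ∷ κ , ∷-∈-covers a κ∈ , λ { zero → ν≤μ 0 ; (suc k) → ν≤κ k }
below-some-cover (a ∷ μ) (b ∷ ν) sμ sν ν≤μ ν<μ | inj₂ tail≡ =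
  pred a ∷ μ , ∈-++⁺ˡ (firstRowCovers-∋ a μ removable) ,
  λ { zero → <⇒≤pred b<a ; (suc k) → ν≤μ (suc k) }
  where
  b<a : b < a
  b<a = +-cancelʳ-< (size μ) b a (subst (λ t → b + t < a + size μ) tail≡ ν<μ)
  removable : suc (part μ 0) < a
  removable = <-≤-trans (s<s (≤-<-trans (≤ₚ∧size≡⇒≥ₚ ν μ (ν≤μ ∘ suc) tail≡ 0) (strict-head sν))) b<a

size≡1+⇒⋢ : ∀ μ κ → suc (size κ) ≡ size μ → ¬ (μ ⊑ κ)
size≡1+⇒⋢ μ κ size≡ μ⊑κ = 1+n≰n (subst (_≤ size κ) (sym size≡) (size-mono-≤ₚ μ κ (⊑⇒≤ₚ μ κ μ⊑κ)))

∈covers⇒⋖ : ∀ {μ κ} → Strict μ → κ ∈ covers μ → StrictPartition κ × κ ⋖ μ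
∈covers⇒⋖ {μ} {κ} sμ κ∈ with covers-sound μ κ κ∈ sμ
... | sκ , κ≤μ , size≡ =
  strict⇒strictPartition sκ , (≤ₚ⇒⊑ κ μ κ≤μ , size≡1+⇒⋢ μ κ size≡) , nothingBetween
  where
  nothingBetween : ∀ ρ → StrictPartition ρ → ¬ ((κ ⊏ ρ) × (ρ ⊏ μ))
  nothingBetween ρ _ ((κ⊑ρ , ρ⋢κ) , (ρ⊑μ , μ⋢ρ)) =
    <⇒≱ (⊏⇒size< κ ρ κ⊑ρ ρ⋢κ) (≤-pred (subst (size ρ <_) (sym size≡) (⊏⇒size< ρ μ ρ⊑μ μ⋢ρ)))

⋖⇒∈covers : ∀ {μ κ} → Strict μ → StrictPartition κ → κ ⋖ μ → κ ∈ covers μ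
⋖⇒∈covers {μ} {κ} sμ pκ ((κ⊑μ , μ⋢κ) , nothingBetween) =
  viaCoverAbove (below-some-cover μ κ sμ sκ (⊑⇒≤ₚ κ μ κ⊑μ) (⊏⇒size< κ μ κ⊑μ μ⋢κ))
  where
  sκ : Strict κ
  sκ = strictPartition⇒strict κ pκ
  viaCoverAbove : Σ (List ℕ) (λ ρ → ρ ∈ covers μ × κ ≤ₚ ρ) → κ ∈ covers μ
  viaCoverAbove (ρ , ρ∈ , κ≤ρ) with covers-sound μ ρ ρ∈ sμ | size κ ≟ size ρ
  ... | sρ , _ , _ | yes size≡ =
    subst (_∈ covers μ) (sym (≤ₚ-antisym sκ sρ κ≤ρ (≤ₚ∧size≡⇒≥ₚ κ ρ κ≤ρ size≡))) ρ∈
  ... | sρ , ρ≤μ , size≡ | no size≢ =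
    contradiction ((≤ₚ⇒⊑ κ ρ κ≤ρ , ρ⋢κ) , (≤ₚ⇒⊑ ρ μ ρ≤μ , size≡1+⇒⋢ μ ρ size≡))
                  (nothingBetween ρ (strict⇒strictPartition sρ))
    where
    ρ⋢κ : ¬ (ρ ⊑ κ)
    ρ⋢κ ρ⊑κ = size≢ (≤-antisym (size-mono-≤ₚ κ ρ κ≤ρ) (size-mono-≤ₚ ρ κ (⊑⇒≤ₚ ρ κ ρ⊑κ)))

-- Enumerating the interval [∅, trapezoid N n]

grow : List ℕ → List ℕ
grow [] = 1 ∷ []
grow (a ∷ μ) = suc a ∷ grow μ

-- μᵢ + k + 2(i − 1) ≤ N for every part: the trapezoid bound without truncated subtraction.
Fits : ℕ → ℕ → List ℕ → Set
Fits N k [] = ⊤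
Fits N k (a ∷ μ) = a + k ≤ N × Fits N (k + 2) μ

Fits-map-suc⁺ : ∀ N k μ → Fits N k μ → Fits (suc N) k (map suc μ)
Fits-map-suc⁺ N k [] _ = tt
Fits-map-suc⁺ N k (a ∷ μ) (fits , rest) = s≤s fits , Fits-map-suc⁺ N (k + 2) μ rest

Fits-map-suc⁻ : ∀ N k μ → Fits (suc N) k (map suc μ) → Fits N k μ
Fits-map-suc⁻ N k [] _ = tt
Fits-map-suc⁻ N k (a ∷ μ) (s≤s fits , rest) = fits , Fits-map-suc⁻ N (k + 2) μ rest

k+2[1+l]≡[k+2]+2l : ∀ k l → k + 2 * suc l ≡ (k + 2) + 2 * l
k+2[1+l]≡[k+2]+2l = solve-∀

Fits-grow⁺ : ∀ N k μ → Fits N k μ → k + 2 * length μ ≤ N → Fits (suc N) k (grow μ)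
Fits-grow⁺ N k [] _ k≤N = s≤s (subst (_≤ N) (+-identityʳ k) k≤N) , tt
Fits-grow⁺ N k (a ∷ μ) (fits , rest) room =
  s≤s fits , Fits-grow⁺ N (k + 2) μ rest (subst (_≤ N) (k+2[1+l]≡[k+2]+2l k (length μ)) room)

Fits-grow⁻ : ∀ N k μ → Fits (suc N) k (grow μ) → Fits N k μ × k + 2 * length μ ≤ N
Fits-grow⁻ N k [] (s≤s k≤N , _) = tt , subst (_≤ N) (sym (+-identityʳ k)) k≤N
Fits-grow⁻ N k (a ∷ μ) (s≤s fits , rest) with Fits-grow⁻ N (k + 2) μ rest
... | rest′ , room = (fits , rest′) , subst (_≤ N) (sym (k+2[1+l]≡[k+2]+2l k (length μ))) room

strict-map-suc : ∀ {μ} → Strict μ → Strict (map suc μ)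
strict-map-suc [] = []
strict-map-suc (_ ∷ []) = z<s ∷ []
strict-map-suc (h ∷ s@(_ ∷ _)) = s<s h ∷ strict-map-suc s

strict-grow : ∀ {μ} → Strict μ → Strict (grow μ)
strict-grow [] = z<s ∷ []
strict-grow (h ∷ []) = s<s h ∷ z<s ∷ []
strict-grow (h ∷ s@(_ ∷ _)) = s<s h ∷ strict-grow s

length-grow : ∀ μ → length (grow μ) ≡ suc (length μ)
length-grow [] = refl
length-grow (a ∷ μ) = cong suc (length-grow μ)

map-suc-injective : ∀ {μ ν} → map suc μ ≡ map suc ν → μ ≡ ν
map-suc-injective {[]} {[]} _ = refl
map-suc-injective {_ ∷ _} {_ ∷ _} eq with ∷-injective eq
... | head≡ , tail≡ = cong₂ _∷_ (suc-injective head≡) (map-suc-injective tail≡)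

grow-injective : ∀ {μ ν} → grow μ ≡ grow ν → μ ≡ ν
grow-injective {[]} {[]} _ = refl
grow-injective {[]} {_ ∷ []} ()
grow-injective {[]} {_ ∷ _ ∷ _} ()
grow-injective {_ ∷ []} {[]} ()
grow-injective {_ ∷ _ ∷ _} {[]} ()
grow-injective {_ ∷ _} {_ ∷ _} eq with ∷-injective eq
... | head≡ , tail≡ = cong₂ _∷_ (suc-injective head≡) (grow-injective tail≡)

map-suc-or-grow : ∀ {μ} → Strict μ →
  (Σ (List ℕ) λ ν → μ ≡ map suc ν × Strict ν) ⊎ (Σ (List ℕ) λ ν → μ ≡ grow ν × Strict ν)
map-suc-or-grow [] = inj₁ ([] , refl , [])
map-suc-or-grow {suc zero ∷ []} _ = inj₂ ([] , refl , [])
map-suc-or-grow {suc zero ∷ _ ∷ _} (s≤s z≤n ∷ (() ∷ _))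
map-suc-or-grow {suc (suc a) ∷ μ} (h ∷ s) with map-suc-or-grow s
... | inj₁ (ν , refl , sν) = inj₁ (suc a ∷ ν , refl , shrink ν h ∷ sν)
  where
  shrink : ∀ ν → part (map suc ν) 0 < suc (suc a) → part ν 0 < suc a
  shrink [] _ = z<s
  shrink (_ ∷ _) (s≤s lt) = lt
... | inj₂ (ν , refl , sν) = inj₂ (suc a ∷ ν , refl , shrink ν h ∷ sν)
  where
  shrink : ∀ ν → part (grow ν) 0 < suc (suc a) → part ν 0 < suc a
  shrink [] _ = z<s
  shrink (_ ∷ _) (s≤s lt) = lt

noOnes : List ℕ → ℕ
noOnes [] = 1
noOnes (1 ∷ _) = 0
noOnes (_ ∷ μ) = noOnes μ

noOnes-map-suc : ∀ {μ} → Strict μ → noOnes (map suc μ) ≡ 1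
noOnes-map-suc [] = refl
noOnes-map-suc {suc _ ∷ _} (_ ∷ s) = noOnes-map-suc s

noOnes-grow : ∀ μ → noOnes (grow μ) ≡ 0
noOnes-grow [] = refl
noOnes-grow (zero ∷ μ) = refl
noOnes-grow (suc _ ∷ μ) = noOnes-grow μ

map-suc≢grow : ∀ {μ} ν → Strict μ → map suc μ ≢ grow ν
map-suc≢grow ν sμ eq = 1+n≢n {0} (trans (sym (noOnes-map-suc sμ)) (trans (cong noOnes eq) (noOnes-grow ν)))

Shape : ℕ → ℕ → List ℕ → Set
Shape N m μ = Strict μ × length μ ≡ m × Fits N 0 μ

ofLength : ℕ → ℕ → List (List ℕ)
ofLength _ zero = [] ∷ []
ofLength zero (suc m) = []
ofLength (suc N) (suc m) with 2 * m ≤? N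
... | yes _ = map (map suc) (ofLength N (suc m)) ++ map grow (ofLength N m)
... | no _ = map (map suc) (ofLength N (suc m))

shape-map-suc : ∀ {N m ν} → Shape N m ν → Shape (suc N) m (map suc ν)
shape-map-suc {N} {m} {ν} (sν , refl , fits) = strict-map-suc sν , length-map suc ν , Fits-map-suc⁺ N 0 ν fits

shape-grow : ∀ {N m ν} → Shape N m ν → 2 * m ≤ N → Shape (suc N) (suc m) (grow ν)
shape-grow {N} {m} {ν} (sν , refl , fits) room = strict-grow sν , length-grow ν , Fits-grow⁺ N 0 ν fits room

∈-map⇒shape : ∀ {N m N′ m′ xs μ} (f : List ℕ → List ℕ) → (∀ {ν} → Shape N m ν → Shape N′ m′ (f ν)) →
              (∀ {ν} → ν ∈ xs → Shape N m ν) → μ ∈ map f xs → Shape N′ m′ μ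
∈-map⇒shape f shape-f sound μ∈ with ∈-map⁻ f μ∈
... | ν , ν∈ , refl = shape-f (sound ν∈)

ofLength-sound : ∀ N m {μ} → μ ∈ ofLength N m → Shape N m μ
ofLength-sound N zero (here refl) = [] , refl , tt
ofLength-sound (suc N) (suc m) μ∈ with 2 * m ≤? N
... | no _ = ∈-map⇒shape (map suc) shape-map-suc (ofLength-sound N (suc m)) μ∈
... | yes room with ∈-++⁻ (map (map suc) (ofLength N (suc m))) μ∈
...   | inj₁ μ∈suc = ∈-map⇒shape (map suc) shape-map-suc (ofLength-sound N (suc m)) μ∈suc
...   | inj₂ μ∈grow = ∈-map⇒shape grow (λ sh → shape-grow sh room) (ofLength-sound N m) μ∈grow

shape-map-suc⁻ : ∀ {N m ν} → Strict ν → Shape (suc N) m (map suc ν) → Shape N m ν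
shape-map-suc⁻ {N} {m} {ν} sν (_ , len , fits) = sν , trans (sym (length-map suc ν)) len , Fits-map-suc⁻ N 0 ν fits

shape-grow⁻ : ∀ {N m ν} → Strict ν → Shape (suc N) (suc m) (grow ν) → Shape N m ν × 2 * m ≤ N
shape-grow⁻ {N} {m} {ν} sν (_ , len , fits) with Fits-grow⁻ N 0 ν fits
... | fits′ , room = (sν , len′ , fits′) , subst (λ l → 2 * l ≤ N) len′ room
  where
  len′ : length ν ≡ m
  len′ = suc-injective (trans (sym (length-grow ν)) len)

ofLength-complete : ∀ N m {μ} → Shape N m μ → μ ∈ ofLength N m
ofLength-complete N zero {[]} _ = here refl
ofLength-complete zero (suc m) {a ∷ μ} (sμ , _ , a≤0 , _) =
  contradiction (subst (_≤ 0) (+-identityʳ a) a≤0) (<⇒≱ (strict-head>0 sμ))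
ofLength-complete (suc N) (suc m) shape@(sμ , _) with map-suc-or-grow sμ | 2 * m ≤? N
... | inj₁ (ν , refl , sν) | yes _ =
  ∈-++⁺ˡ (∈-map⁺ (map suc) (ofLength-complete N (suc m) (shape-map-suc⁻ sν shape)))
... | inj₁ (ν , refl , sν) | no _ =
  ∈-map⁺ (map suc) (ofLength-complete N (suc m) (shape-map-suc⁻ sν shape))
... | inj₂ (ν , refl , sν) | yes _ =
  ∈-++⁺ʳ (map (map suc) (ofLength N (suc m))) (∈-map⁺ grow (ofLength-complete N m (proj₁ (shape-grow⁻ sν shape))))
... | inj₂ (ν , refl , sν) | no ¬room = contradiction (proj₂ (shape-grow⁻ sν shape)) ¬room

ofLength-unique : ∀ N m → Unique (ofLength N m)
ofLength-unique N zero = [] ∷ []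
ofLength-unique zero (suc m) = []
ofLength-unique (suc N) (suc m) with 2 * m ≤? N
... | no _ = Unique.map⁺ map-suc-injective (ofLength-unique N (suc m))
... | yes _ = Unique.++⁺ (Unique.map⁺ map-suc-injective (ofLength-unique N (suc m)))
                         (Unique.map⁺ grow-injective (ofLength-unique N m)) disjoint
  where
  disjoint : ∀ {μ} → μ ∈ map (map suc) (ofLength N (suc m)) × μ ∈ map grow (ofLength N m) → ⊥
  disjoint (μ∈suc , μ∈grow) with ∈-map⁻ (map suc) μ∈suc | ∈-map⁻ grow μ∈grow
  ... | ν , ν∈ , refl | ν′ , _ , eq = map-suc≢grow ν′ (proj₁ (ofLength-sound N (suc m) ν∈)) eq

interval : ℕ → ℕ → List (List ℕ)
interval N zero = ofLength N zero
interval N (suc n) = interval N n ++ ofLength N (suc n)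

interval-sound : ∀ N n {μ} → μ ∈ interval N n → Strict μ × length μ ≤ n × Fits N 0 μ
interval-sound N zero μ∈ with ofLength-sound N zero μ∈
... | sμ , len , fits = sμ , ≤-reflexive len , fits
interval-sound N (suc n) μ∈ with ∈-++⁻ (interval N n) μ∈
... | inj₁ μ∈′ with interval-sound N n μ∈′
...   | sμ , len , fits = sμ , m≤n⇒m≤1+n len , fits
interval-sound N (suc n) μ∈ | inj₂ μ∈′ with ofLength-sound N (suc n) μ∈′
...   | sμ , len , fits = sμ , ≤-reflexive len , fits

interval-complete : ∀ N n {μ} → Strict μ → length μ ≤ n → Fits N 0 μ → μ ∈ interval N n
interval-complete N zero sμ len fits = ofLength-complete N zero (sμ , n≤0⇒n≡0 len , fits)
interval-complete N (suc n) sμ len fits with m≤n⇒m<n∨m≡n len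
... | inj₁ (s≤s len′) = ∈-++⁺ˡ (interval-complete N n sμ len′ fits)
... | inj₂ len≡ = ∈-++⁺ʳ (interval N n) (ofLength-complete N (suc n) (sμ , len≡ , fits))

interval-unique : ∀ N n → Unique (interval N n)
interval-unique N zero = ofLength-unique N zero
interval-unique N (suc n) = Unique.++⁺ (interval-unique N n) (ofLength-unique N (suc n)) disjoint
  where
  disjoint : ∀ {μ} → μ ∈ interval N n × μ ∈ ofLength N (suc n) → ⊥
  disjoint (μ∈ , μ∈′) =
    1+n≰n (subst (_≤ n) (proj₁ (proj₂ (ofLength-sound N (suc n) μ∈′))) (proj₁ (proj₂ (interval-sound N n μ∈))))

part≤N∸k⇒part+k≤N : ∀ {a} N k → 0 < a → a ≤ N ∸ k → a + k ≤ N
part≤N∸k⇒part+k≤N {a} N k a>0 a≤ with k ≤? N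
... | yes k≤N = subst (a + k ≤_) (m∸n+n≡m k≤N) (+-monoˡ-≤ k a≤)
... | no k≰N = contradiction (subst (a ≤_) (m≤n⇒m∸n≡0 (<⇒≤ (≰⇒> k≰N))) a≤) (<⇒≱ a>0)

≤ₚtrapezoid⇒ : ∀ N k n {μ} → Strict μ → μ ≤ₚ trapezoid (N ∸ k) n → length μ ≤ n × Fits N k μ
≤ₚtrapezoid⇒ N k n [] _ = z≤n , tt
≤ₚtrapezoid⇒ N k zero sμ@(_ ∷ _) μ≤ = contradiction (μ≤ 0) (<⇒≱ (strict-head>0 sμ))
≤ₚtrapezoid⇒ N k (suc n) {a ∷ μ} sμ@(_ ∷ s) μ≤ with ≤ₚtrapezoid⇒ N (k + 2) n s tail≤
  where
  tail≤ : μ ≤ₚ trapezoid (N ∸ (k + 2)) n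
  tail≤ j = subst (λ t → part μ j ≤ part (trapezoid t n) j) (∸-+-assoc N k 2) (μ≤ (suc j))
... | len , fits = s≤s len , part≤N∸k⇒part+k≤N N k (strict-head>0 sμ) (μ≤ 0) , fits

⇒≤ₚtrapezoid : ∀ N k n μ → length μ ≤ n → Fits N k μ → μ ≤ₚ trapezoid (N ∸ k) n
⇒≤ₚtrapezoid N k n [] _ _ j = z≤n
⇒≤ₚtrapezoid N k (suc n) (a ∷ μ) (s≤s len) (a+k≤N , fits) zero = m+n≤o⇒m≤o∸n a a+k≤N
⇒≤ₚtrapezoid N k (suc n) (a ∷ μ) (s≤s len) (a+k≤N , fits) (suc j) =
  subst (λ t → part μ j ≤ part (trapezoid t n) j) (sym (∸-+-assoc N k 2)) (⇒≤ₚtrapezoid N (k + 2) n μ len fits j)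

∈interval⇔inInterval : ∀ N n μ → μ ∈ interval N n ⇔ InInterval (trapezoid N n) μ
∈interval⇔inInterval N n μ = mk⇔ to from
  where
  to : μ ∈ interval N n → InInterval (trapezoid N n) μ
  to μ∈ with interval-sound N n μ∈
  ... | sμ , len , fits = strict⇒strictPartition sμ , ≤ₚ⇒⊑ μ (trapezoid N n) (⇒≤ₚtrapezoid N 0 n μ len fits)
  from : InInterval (trapezoid N n) μ → μ ∈ interval N n
  from (pμ , μ⊑) with strictPartition⇒strict μ pμ
  ... | sμ with ≤ₚtrapezoid⇒ N 0 n sμ (⊑⇒≤ₚ μ (trapezoid N n) μ⊑)
  ...   | len , fits = interval-complete N n sμ len fits

ddeg : List ℕ → ℕ
ddeg μ = length (covers μ)

ddeg-∷ : ∀ a μ → ddeg (a ∷ μ) ≡ length (firstRowCovers a μ) + ddeg μ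
ddeg-∷ a μ = trans (length-++ (firstRowCovers a μ)) (cong (length (firstRowCovers a μ) +_) (length-map (a ∷_) (covers μ)))

length-firstRowCovers-suc : ∀ a b μ ν → length (firstRowCovers (suc a) (suc b ∷ μ)) ≡ length (firstRowCovers a (b ∷ ν))
length-firstRowCovers-suc a b μ ν with suc (suc b) <? suc a | suc b <? a
... | yes _ | yes _ = refl
... | no _ | no _ = refl
... | yes lt | no ¬lt = contradiction (<-pred lt) ¬lt
... | no ¬lt | yes lt = contradiction (s<s lt) ¬lt

ddeg-map-suc : ∀ {μ} → Strict μ → ddeg (map suc μ) ≡ ddeg μ
ddeg-map-suc [] = refl
ddeg-map-suc {suc zero ∷ []} _ = refl
ddeg-map-suc {suc (suc a) ∷ []} _ = refl
ddeg-map-suc {a ∷ b ∷ μ} (_ ∷ s) = begin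
  ddeg (suc a ∷ suc b ∷ map suc μ)
    ≡⟨ ddeg-∷ (suc a) (suc b ∷ map suc μ) ⟩
  length (firstRowCovers (suc a) (suc b ∷ map suc μ)) + ddeg (map suc (b ∷ μ))
    ≡⟨ cong₂ _+_ (length-firstRowCovers-suc a b (map suc μ) μ) (ddeg-map-suc s) ⟩
  length (firstRowCovers a (b ∷ μ)) + ddeg (b ∷ μ)
    ≡⟨ ddeg-∷ a (b ∷ μ) ⟨
  ddeg (a ∷ b ∷ μ) ∎
  where open ≡-Reasoning

ddeg-grow : ∀ {μ} → Strict μ → ddeg (grow μ) ≡ ddeg μ + noOnes μ
ddeg-grow [] = refl
ddeg-grow {suc zero ∷ []} _ = refl
ddeg-grow {suc (suc a) ∷ []} _ = refl
ddeg-grow {suc zero ∷ _ ∷ _} (s≤s z≤n ∷ (() ∷ _))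
ddeg-grow {a@(suc (suc _)) ∷ b ∷ μ} (_ ∷ s) = begin
  ddeg (suc a ∷ suc b ∷ grow μ)
    ≡⟨ ddeg-∷ (suc a) (suc b ∷ grow μ) ⟩
  length (firstRowCovers (suc a) (suc b ∷ grow μ)) + ddeg (grow (b ∷ μ))
    ≡⟨ cong₂ _+_ (length-firstRowCovers-suc a b (grow μ) μ) (ddeg-grow s) ⟩
  length (firstRowCovers a (b ∷ μ)) + (ddeg (b ∷ μ) + noOnes (b ∷ μ))
    ≡⟨ +-assoc (length (firstRowCovers a (b ∷ μ))) (ddeg (b ∷ μ)) (noOnes (b ∷ μ)) ⟨
  (length (firstRowCovers a (b ∷ μ)) + ddeg (b ∷ μ)) + noOnes (b ∷ μ)
    ≡⟨ cong (_+ noOnes (b ∷ μ)) (ddeg-∷ a (b ∷ μ)) ⟨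
  ddeg (a ∷ b ∷ μ) + noOnes (b ∷ μ) ∎
  where open ≡-Reasoning

module _ (f g h : List ℕ → ℕ)
         (f∘map-suc : ∀ {ν} → Strict ν → f (map suc ν) ≡ g ν)
         (f∘grow : ∀ {ν} → Strict ν → f (grow ν) ≡ h ν) where

  ∑-map-suc : ∀ N m → ∑ f (map (map suc) (ofLength N m)) ≡ ∑ g (ofLength N m)
  ∑-map-suc N m = trans (∑-map f (map suc) (ofLength N m))
                        (∑-cong (ofLength N m) (λ ν∈ → f∘map-suc (proj₁ (ofLength-sound N m ν∈))))

  ∑-grow : ∀ N m → ∑ f (map grow (ofLength N m)) ≡ ∑ h (ofLength N m)
  ∑-grow N m = trans (∑-map f grow (ofLength N m))
                     (∑-cong (ofLength N m) (λ ν∈ → f∘grow (proj₁ (ofLength-sound N m ν∈))))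

  ∑-ofLength-suc : ∀ N m → 2 * m ≤ N →
                   ∑ f (ofLength (suc N) (suc m)) ≡ ∑ g (ofLength N (suc m)) + ∑ h (ofLength N m)
  ∑-ofLength-suc N m room with 2 * m ≤? N
  ... | yes _ = trans (∑-++ f (map (map suc) (ofLength N (suc m))) _) (cong₂ _+_ (∑-map-suc N (suc m)) (∑-grow N m))
  ... | no ¬room = contradiction room ¬room

  ∑-interval-suc : ∀ N n → 2 * n ≤ N →
                   ∑ f (interval (suc N) (suc n)) ≡ ∑ g (interval N (suc n)) + ∑ h (interval N n)
  ∑-interval-suc N zero room = begin
    ∑ f (([] ∷ []) ++ ofLength (suc N) 1)                  ≡⟨ ∑-++ f ([] ∷ []) (ofLength (suc N) 1) ⟩
    ∑ f ([] ∷ []) + ∑ f (ofLength (suc N) 1)               ≡⟨ cong₂ _+_ (cong (_+ 0) (f∘map-suc [])) (∑-ofLength-suc N 0 room) ⟩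
    ∑ g ([] ∷ []) + (∑ g (ofLength N 1) + ∑ h ([] ∷ []))   ≡⟨ +-assoc (∑ g ([] ∷ [])) _ _ ⟨
    ∑ g ([] ∷ []) + ∑ g (ofLength N 1) + ∑ h ([] ∷ [])     ≡⟨ cong (_+ ∑ h ([] ∷ [])) (∑-++ g ([] ∷ []) (ofLength N 1)) ⟨
    ∑ g (interval N 1) + ∑ h (interval N 0)                ∎
    where open ≡-Reasoning
  ∑-interval-suc N (suc n) room = begin
    ∑ f (interval (suc N) (suc n) ++ ofLength (suc N) (2 + n))
      ≡⟨ ∑-++ f (interval (suc N) (suc n)) _ ⟩
    ∑ f (interval (suc N) (suc n)) + ∑ f (ofLength (suc N) (2 + n))
      ≡⟨ cong₂ _+_ (∑-interval-suc N n (≤-trans (*-monoʳ-≤ 2 (n≤1+n n)) room)) (∑-ofLength-suc N (suc n) room) ⟩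
    (∑ g (interval N (suc n)) + ∑ h (interval N n)) + (∑ g (ofLength N (2 + n)) + ∑ h (ofLength N (suc n)))
      ≡⟨ +-interchange (∑ g (interval N (suc n))) _ _ _ ⟩
    (∑ g (interval N (suc n)) + ∑ g (ofLength N (2 + n))) + (∑ h (interval N n) + ∑ h (ofLength N (suc n)))
      ≡⟨ cong₂ _+_ (∑-++ g (interval N (suc n)) _) (∑-++ h (interval N n) _) ⟨
    ∑ g (interval N (2 + n)) + ∑ h (interval N (suc n)) ∎
    where open ≡-Reasoning

2[1+m]≡2+2m : ∀ m → 2 * suc m ≡ 2 + 2 * m
2[1+m]≡2+2m m = *-distribˡ-+ 2 1 m

ofLength-empty : ∀ N m → suc N < 2 * m → ofLength N m ≡ []
ofLength-empty N zero ()
ofLength-empty zero (suc m) _ = refl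
ofLength-empty (suc N) (suc m) N+2<2[1+m] with 2 * m ≤? N
... | yes room = contradiction room (<⇒≱ N<2m)
  where
  N<2m : N < 2 * m
  N<2m = <-pred (<-pred (subst (suc (suc N) <_) (2[1+m]≡2+2m m) N+2<2[1+m]))
... | no _ = cong (map (map suc)) (ofLength-empty N (suc m) (<-trans (n<1+n (suc N)) N+2<2[1+m]))

pascal : ∀ n k → suc n C suc k ≡ n C k + n C suc k
pascal n k = sym (nCk+nC[k+1]≡[n+1]C[k+1] n k)

absorption : ∀ N k → suc k * (suc N C suc k) ≡ suc N * (N C k)
absorption zero zero = refl
absorption zero (suc k) = *-zeroʳ (suc (suc k))
absorption (suc N) zero = trans (*-identityˡ (suc (suc N) C 1)) (trans (nC1≡n (suc (suc N))) (sym (*-identityʳ (suc (suc N)))))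
absorption (suc N) (suc k) = begin
  suc (suc k) * (suc (suc N) C suc (suc k))
    ≡⟨ cong (suc (suc k) *_) (pascal (suc N) (suc k)) ⟩
  suc (suc k) * (suc N C suc k + suc N C suc (suc k))
    ≡⟨ *-distribˡ-+ (suc (suc k)) (suc N C suc k) _ ⟩
  (suc N C suc k + suc k * (suc N C suc k)) + suc (suc k) * (suc N C suc (suc k))
    ≡⟨ cong₂ (λ x y → (suc N C suc k + x) + y) (absorption N k) (absorption N (suc k)) ⟩
  (suc N C suc k + suc N * (N C k)) + suc N * (N C suc k)
    ≡⟨ +-assoc (suc N C suc k) _ _ ⟩
  suc N C suc k + (suc N * (N C k) + suc N * (N C suc k))
    ≡⟨ cong (suc N C suc k +_) (trans (cong (suc N *_) (pascal N k)) (*-distribˡ-+ (suc N) (N C k) _)) ⟨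
  suc (suc N) * (suc N C suc k) ∎
  where open ≡-Reasoning

absorption-complement : ∀ N n → suc N * (N C n) + n * (suc N C n) ≡ suc N * (suc N C n)
absorption-complement N zero = +-identityʳ (suc N * 1)
absorption-complement N (suc k) = begin
  suc N * (N C suc k) + suc k * (suc N C suc k) ≡⟨ cong (suc N * (N C suc k) +_) (absorption N k) ⟩
  suc N * (N C suc k) + suc N * (N C k)         ≡⟨ +-comm (suc N * (N C suc k)) _ ⟩
  suc N * (N C k) + suc N * (N C suc k)         ≡⟨ *-distribˡ-+ (suc N) (N C k) _ ⟨
  suc N * (N C k + N C suc k)                   ≡⟨ cong (suc N *_) (pascal N k) ⟨
  suc N * (suc N C suc k)                       ∎
  where open ≡-Reasoning

central-symmetry : ∀ n → suc (2 * n) C suc n ≡ suc (2 * n) C n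
central-symmetry n = trans (nCk≡nC[n∸k] (s≤s (m≤m+n n (n + 0)))) (cong (suc (2 * n) C_) 2n∸n≡n)
  where
  2n∸n≡n : 2 * n ∸ n ≡ n
  2n∸n≡n = trans (m+n∸m≡n n (n + 0)) (+-identityʳ n)

central-absorption : ∀ n → suc n * (2 * n C suc n) ≡ n * (2 * n C n)
central-absorption zero = refl
central-absorption (suc k) = begin
  suc (suc k) * (2 * suc k C suc (suc k))          ≡⟨ cong (λ N → suc (suc k) * (N C suc (suc k))) (2[1+m]≡2+2m k) ⟩
  suc (suc k) * (suc (suc (2 * k)) C suc (suc k))  ≡⟨ absorption (suc (2 * k)) (suc k) ⟩
  suc (suc (2 * k)) * (suc (2 * k) C suc k)        ≡⟨ cong (suc (suc (2 * k)) *_) (central-symmetry k) ⟩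
  suc (suc (2 * k)) * (suc (2 * k) C k)            ≡⟨ absorption (suc (2 * k)) k ⟨
  suc k * (suc (suc (2 * k)) C suc k)              ≡⟨ cong (λ N → suc k * (N C suc k)) (2[1+m]≡2+2m k) ⟨
  suc k * (2 * suc k C suc k)                      ∎
  where open ≡-Reasoning

∑-interval-saturated : ∀ (f : List ℕ → ℕ) {N} n → N ≡ 2 * n → ∑ f (interval N (suc n)) ≡ ∑ f (interval N n)
∑-interval-saturated f n refl = begin
  ∑ f (interval (2 * n) n ++ ofLength (2 * n) (suc n))     ≡⟨ ∑-++ f (interval (2 * n) n) _ ⟩
  ∑ f (interval (2 * n) n) + ∑ f (ofLength (2 * n) (suc n)) ≡⟨ cong (λ xs → ∑ f (interval (2 * n) n) + ∑ f xs) (ofLength-empty (2 * n) (suc n) 2n+1<2[1+n]) ⟩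
  ∑ f (interval (2 * n) n) + 0                               ≡⟨ +-identityʳ _ ⟩
  ∑ f (interval (2 * n) n)                                   ∎
  where
  open ≡-Reasoning
  2n+1<2[1+n] : suc (2 * n) < 2 * suc n
  2n+1<2[1+n] = subst (suc (2 * n) <_) (sym (2[1+m]≡2+2m n)) ≤-refl

no-room⇒N≡2n : ∀ N n → 2 * n ≤ N → ¬ (2 * suc n ≤ suc N) → N ≡ 2 * n
no-room⇒N≡2n N n room ¬room = ≤-antisym (≤-pred (<-pred (subst (suc N <_) (2[1+m]≡2+2m n) (≰⇒> ¬room)))) room

2[1+n]≰1 : ∀ n → ¬ (2 * suc n ≤ 1)
2[1+n]≰1 n le with subst (_≤ 1) (2[1+m]≡2+2m n) le
... | s≤s ()

2[1+n]≤2+N⇒2n≤N : ∀ N n → 2 * suc n ≤ suc (suc N) → 2 * n ≤ N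
2[1+n]≤2+N⇒2n≤N N n le = ≤-pred (≤-pred (subst (_≤ suc (suc N)) (2[1+m]≡2+2m n) le))

2[1+n]≤1+N⇒2n≤N : ∀ N n → 2 * suc n ≤ suc N → 2 * n ≤ N
2[1+n]≤1+N⇒2n≤N N n le = 2[1+n]≤2+N⇒2n≤N N n (m≤n⇒m≤1+n le)

count-closed : ∀ N n → 2 * n ≤ suc N → ∑ (const 1) (interval N n) ≡ suc N C n
count-closed-suc : ∀ N n → 2 * n ≤ N → ∑ (const 1) (interval N (suc n)) ≡ suc N C suc n

count-closed N zero _ = refl
count-closed zero (suc n) le = contradiction le (2[1+n]≰1 n)
count-closed (suc N) (suc n) le = begin
  ∑ (const 1) (interval (suc N) (suc n))
    ≡⟨ ∑-interval-suc (const 1) (const 1) (const 1) (λ _ → refl) (λ _ → refl) N n room ⟩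
  ∑ (const 1) (interval N (suc n)) + ∑ (const 1) (interval N n)
    ≡⟨ cong₂ _+_ (count-closed-suc N n room) (count-closed N n (m≤n⇒m≤1+n room)) ⟩
  suc N C suc n + suc N C n
    ≡⟨ +-comm (suc N C suc n) (suc N C n) ⟩
  suc N C n + suc N C suc n
    ≡⟨ pascal (suc N) n ⟨
  suc (suc N) C suc n ∎
  where
  open ≡-Reasoning
  room = 2[1+n]≤2+N⇒2n≤N N n le

count-closed-suc N n room with 2 * suc n ≤? suc N
... | yes le = count-closed N (suc n) le
... | no ¬le = begin
  ∑ (const 1) (interval N (suc n)) ≡⟨ ∑-interval-saturated (const 1) n N≡2n ⟩
  ∑ (const 1) (interval N n)       ≡⟨ count-closed N n (m≤n⇒m≤1+n room) ⟩
  suc N C n                        ≡⟨ cong (λ M → suc M C n) N≡2n ⟩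
  suc (2 * n) C n                  ≡⟨ central-symmetry n ⟨
  suc (2 * n) C suc n              ≡⟨ cong (λ M → suc M C suc n) N≡2n ⟨
  suc N C suc n                    ∎
  where
  open ≡-Reasoning
  N≡2n = no-room⇒N≡2n N n room ¬le

noOnes-closed : ∀ N n → 2 * n ≤ N → ∑ noOnes (interval N n) ≡ N C n
noOnes-closed N zero _ = refl
noOnes-closed zero (suc n) le = contradiction (m≤n⇒m≤1+n le) (2[1+n]≰1 n)
noOnes-closed (suc N) (suc n) le = begin
  ∑ noOnes (interval (suc N) (suc n))
    ≡⟨ ∑-interval-suc noOnes (const 1) (const 0) noOnes-map-suc (λ {ν} _ → noOnes-grow ν) N n room ⟩
  ∑ (const 1) (interval N (suc n)) + ∑ (const 0) (interval N n)
    ≡⟨ cong₂ _+_ (count-closed-suc N n room) (∑-const-0 (interval N n)) ⟩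
  suc N C suc n + 0
    ≡⟨ +-identityʳ _ ⟩
  suc N C suc n ∎
  where
  open ≡-Reasoning
  room = 2[1+n]≤1+N⇒2n≤N N n le

ddeg-closed : ∀ N n → 2 * n ≤ suc N → ∑ ddeg (interval N n) ≡ n * (N C n)
ddeg-closed-suc : ∀ N n → 2 * n ≤ N → ∑ ddeg (interval N (suc n)) ≡ suc n * (N C suc n)

ddeg-closed N zero _ = refl
ddeg-closed zero (suc n) le = contradiction le (2[1+n]≰1 n)
ddeg-closed (suc N) (suc n) le = begin
  ∑ ddeg (interval (suc N) (suc n))
    ≡⟨ ∑-interval-suc ddeg ddeg (λ ν → ddeg ν + noOnes ν) ddeg-map-suc ddeg-grow N n room ⟩
  ∑ ddeg (interval N (suc n)) + ∑ (λ ν → ddeg ν + noOnes ν) (interval N n)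
    ≡⟨ cong (∑ ddeg (interval N (suc n)) +_) (∑-+ ddeg noOnes (interval N n)) ⟩
  ∑ ddeg (interval N (suc n)) + (∑ ddeg (interval N n) + ∑ noOnes (interval N n))
    ≡⟨ cong₂ _+_ (ddeg-closed-suc N n room) (cong₂ _+_ (ddeg-closed N n (m≤n⇒m≤1+n room)) (noOnes-closed N n room)) ⟩
  suc n * (N C suc n) + (n * (N C n) + N C n)
    ≡⟨ collect n (N C n) (N C suc n) ⟩
  suc n * (N C n + N C suc n)
    ≡⟨ cong (suc n *_) (pascal N n) ⟨
  suc n * (suc N C suc n) ∎
  where
  open ≡-Reasoning
  room = 2[1+n]≤2+N⇒2n≤N N n le
  collect : ∀ n x y → suc n * y + (n * x + x) ≡ suc n * (x + y)
  collect = solve-∀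

ddeg-closed-suc N n room with 2 * suc n ≤? suc N
... | yes le = ddeg-closed N (suc n) le
... | no ¬le = begin
  ∑ ddeg (interval N (suc n)) ≡⟨ ∑-interval-saturated ddeg n N≡2n ⟩
  ∑ ddeg (interval N n)       ≡⟨ ddeg-closed N n (m≤n⇒m≤1+n room) ⟩
  n * (N C n)                 ≡⟨ cong (λ M → n * (M C n)) N≡2n ⟩
  n * (2 * n C n)             ≡⟨ central-absorption n ⟨
  suc n * (2 * n C suc n)     ≡⟨ cong (λ M → suc n * (M C suc n)) N≡2n ⟨
  suc n * (N C suc n)         ∎
  where
  open ≡-Reasoning
  N≡2n = no-room⇒N≡2n N n room ¬le

size-trapezoid : ∀ M m → size (trapezoid (M + 2 * m) (suc m)) ≡ suc m * M + m * suc m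
size-trapezoid M zero = refl
size-trapezoid M (suc k) = begin
  M + 2 * suc k + size (trapezoid (M + 2 * suc k ∸ 2) (suc k))
    ≡⟨ cong (λ N → M + 2 * suc k + size (trapezoid (N ∸ 2) (suc k))) (M+2[1+k]≡2+[M+2k] M k) ⟩
  M + 2 * suc k + size (trapezoid (M + 2 * k) (suc k))
    ≡⟨ cong (M + 2 * suc k +_) (size-trapezoid M k) ⟩
  M + 2 * suc k + (suc k * M + k * suc k)
    ≡⟨ collect M k ⟩
  suc (suc k) * M + suc k * suc (suc k) ∎
  where
  open ≡-Reasoning
  M+2[1+k]≡2+[M+2k] : ∀ M k → M + 2 * suc k ≡ 2 + (M + 2 * k)
  M+2[1+k]≡2+[M+2k] = solve-∀
  collect : ∀ M k → M + 2 * suc k + (suc k * M + k * suc k) ≡ suc (suc k) * M + suc k * suc (suc k)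
  collect = solve-∀

size-trapezoid+n² : ∀ N n → 2 * n ≤ suc N → size (trapezoid N n) + n * n ≡ n * suc N
size-trapezoid+n² N zero _ = refl
size-trapezoid+n² N (suc m) le = begin
  size (trapezoid N (suc m)) + suc m * suc m
    ≡⟨ cong (λ M → size (trapezoid M (suc m)) + suc m * suc m) N≡M+2m ⟩
  size (trapezoid (N ∸ 2 * m + 2 * m) (suc m)) + suc m * suc m
    ≡⟨ cong (_+ suc m * suc m) (size-trapezoid (N ∸ 2 * m) m) ⟩
  suc m * (N ∸ 2 * m) + m * suc m + suc m * suc m
    ≡⟨ collect (N ∸ 2 * m) m ⟩
  suc m * suc (N ∸ 2 * m + 2 * m)
    ≡⟨ cong (λ M → suc m * suc M) N≡M+2m ⟨
  suc m * suc N ∎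
  where
  open ≡-Reasoning
  N≡M+2m : N ≡ N ∸ 2 * m + 2 * m
  N≡M+2m = sym (m∸n+n≡m (2[1+n]≤1+N⇒2n≤N N m le))
  collect : ∀ M m → suc m * M + m * suc m + suc m * suc m ≡ suc m * suc (M + 2 * m)
  collect = solve-∀

ddeg-sum-identity : ∀ N n → 2 * n ≤ suc N → n * (N C n) * suc N ≡ size (trapezoid N n) * (suc N C n)
ddeg-sum-identity N n room = +-cancelʳ-≡ (n * n * y) (n * x * suc N) (size (trapezoid N n) * y) (begin
  n * x * suc N + n * n * y       ≡⟨ regroup n x y N ⟩
  n * (suc N * x + n * y)         ≡⟨ cong (n *_) (absorption-complement N n) ⟩
  n * (suc N * y)                 ≡⟨ *-assoc n (suc N) y ⟨
  n * suc N * y                   ≡⟨ cong (_* y) (size-trapezoid+n² N n room) ⟨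
  (size (trapezoid N n) + n * n) * y ≡⟨ *-distribʳ-+ y (size (trapezoid N n)) (n * n) ⟩
  size (trapezoid N n) * y + n * n * y ∎)
  where
  open ≡-Reasoning
  x = N C n
  y = suc N C n
  regroup : ∀ n x y N → n * x * suc N + n * n * y ≡ n * (suc N * x + n * y)
  regroup = solve-∀

enumeration↭interval : ∀ N n {L} → Enumerates (trapezoid N n) L → L ↭ interval N n
enumeration↭interval N n (uniqueL , L-spec) = same-members⇒↭ uniqueL (interval-unique N n)
  (λ {μ} → ⇔-trans (mk⇔ (proj₁ (L-spec μ)) (proj₂ (L-spec μ))) (⇔-sym (∈interval⇔inInterval N n μ)))

coverList↭covers : ∀ {lam cover x} → CoverLists lam cover → InInterval lam x → cover x ↭ covers x
coverList↭covers {lam} {cover} {x} coverLists x∈@(px , x⊑lam) with coverLists x x∈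
... | uniqueC , C-spec = same-members⇒↭ uniqueC (covers-unique x) (mk⇔ to from)
  where
  sx = strictPartition⇒strict x px
  to : ∀ {y} → y ∈ cover x → y ∈ covers x
  to {y} y∈C with proj₁ (C-spec y) y∈C
  ... | (py , _) , y⋖x = ⋖⇒∈covers sx py y⋖x
  from : ∀ {y} → y ∈ covers x → y ∈ cover x
  from {y} y∈ with ∈covers⇒⋖ sx y∈
  ... | py , y⋖x = proj₂ (C-spec y) ((py , λ i j → x⊑lam i j ∘ proj₁ (proj₁ y⋖x) i j) , y⋖x)

-- The identity holds for n = 0 as well.
theorem5p4 : (N n : ℕ) → 1 ≤ n → 2 * n ≤ N + 1 →
    (L : List (List ℕ)) → Enumerates (trapezoid N n) L →
    (C : List ℕ → List (List ℕ)) → CoverLists (trapezoid N n) C →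
    totalDdeg L C * (N + 1) ≡ size (trapezoid N n) * length L
theorem5p4 N n _ room L enumL cover coverLists = begin
  totalDdeg L cover * (N + 1)             ≡⟨ cong (_* (N + 1)) totalDdeg≡ ⟩
  n * (N C n) * (N + 1)               ≡⟨ cong (n * (N C n) *_) (+-comm N 1) ⟩
  n * (N C n) * suc N                 ≡⟨ ddeg-sum-identity N n room′ ⟩
  size (trapezoid N n) * (suc N C n)  ≡⟨ cong (size (trapezoid N n) *_) length≡ ⟨
  size (trapezoid N n) * length L     ∎
  where
  open ≡-Reasoning
  room′ : 2 * n ≤ suc N
  room′ = subst (2 * n ≤_) (+-comm N 1) room
  L↭ = enumeration↭interval N n enumL
  totalDdeg≡ : totalDdeg L cover ≡ n * (N C n)
  totalDdeg≡ = begin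
    ∑ (length ∘ cover) L        ≡⟨ ∑-cong L (λ x∈L → ↭-length (coverList↭covers {trapezoid N n} coverLists (proj₁ (proj₂ enumL _) x∈L))) ⟩
    ∑ ddeg L                ≡⟨ ∑-↭ ddeg L↭ ⟩
    ∑ ddeg (interval N n)   ≡⟨ ddeg-closed N n room′ ⟩
    n * (N C n)             ∎
  length≡ : length L ≡ suc N C n
  length≡ = trans (↭-length L↭) (trans (sym (∑-const-1 (interval N n))) (count-closed N n room′))
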